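{- In the edge-distinguishing game (EDGe) played on the path $P_6$ (with $\lambda(P_6)$ colors), Player 1 has a winning strategy.
   Context: $P_n$ is the path on $n$ vertices. For a positive integer $k$ let $[k]=\{1,\dots,k\}$. A $k$-coloring $c:V(G)\to[k]$ induces $c'(\{u,v\})=\{c(u),c(v)\}$ (a multiset); $c$ is edge-distinguishing if $c'$ is injective, and $\lambda(G)$ is the least $k$ admitting such a coloring. A partial coloring on $U\subseteq V(G)$ has partial induced edge coloring on $G[U]$. EDGe on $G$: two players, Player 1 first, alternately color an uncolored vertex with a color from $[\lambda(G)]$; a move is legal iff afterwards the partial induced edge coloring of the colored vertices is injective. The player making the last legal move wins. A winning strategy guarantees a win regardless of the opponent's play. -}

module Defs where

open import Data.Nat using (ℕ; suc; _<_)
open import Data.Fin using (Fin; toℕ)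
open import Data.Maybe using (Maybe; just; nothing)
open import Data.Product using (Σ; _×_; ∃)
open import Data.Sum using (_⊎_)
open import Relation.Binary.PropositionalEquality using (_≡_)
open import Relation.Nullary using (¬_)

record Graph : Set₁ where
  field
    n   : ℕ
    Adj : Fin n → Fin n → Set
open Graph public

Path : ℕ → Graph
Path m = record { n = m ; Adj = λ i j → (toℕ j ≡ suc (toℕ i)) ⊎ (toℕ i ≡ suc (toℕ j)) }

SamePair : {A : Set} → A → A → A → A → Set
SamePair a b x y = ((a ≡ x) × (b ≡ y)) ⊎ ((a ≡ y) × (b ≡ x))

-- Colors [k] are represented by Fin k.
-- A k-coloring c is edge-distinguishing if the induced edge coloring
-- {u,v} ↦ {c u, c v} (multiset) is injective on edges.
EdgeDistinguishing : (G : Graph) (k : ℕ) → (Fin (n G) → Fin k) → Set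
EdgeDistinguishing G k c =
  ∀ u v x y → Adj G u v → Adj G x y →
  SamePair (c u) (c v) (c x) (c y) → SamePair u v x y

IsLambda : Graph → ℕ → Set
IsLambda G k =
  (Σ (Fin (n G) → Fin k) (EdgeDistinguishing G k)) ×
  (∀ m → m < k → ¬ Σ (Fin (n G) → Fin m) (EdgeDistinguishing G m))

-- Partial colorings: nothing = uncolored.
Partial : Graph → ℕ → Set
Partial G k = Fin (n G) → Maybe (Fin k)

PartialEdgeDistinguishing : (G : Graph) (k : ℕ) → Partial G k → Set
PartialEdgeDistinguishing G k p =
  ∀ u v x y (a b a' b' : Fin k) → Adj G u v → Adj G x y →
  p u ≡ just a → p v ≡ just b → p x ≡ just a' → p y ≡ just b' →
  SamePair a b a' b' → SamePair u v x y

record Move (G : Graph) (k : ℕ) (p p' : Partial G k) : Set where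
  field
    v         : Fin (n G)
    c         : Fin k
    uncolored : p v ≡ nothing
    colored   : p' v ≡ just c
    unchanged : ∀ w → ¬ (w ≡ v) → p' w ≡ p w

LegalMove : (G : Graph) (k : ℕ) → Partial G k → Partial G k → Set
LegalMove G k p p' = Move G k p p' × PartialEdgeDistinguishing G k p'

-- Normal play (last legal move wins). Since every move colors a new vertex the
-- game is finite, so these inductive predicates express existence of a winning
-- strategy for the player to move (Wins) / for the player who just moved (Loses).
mutual
  data Wins (G : Graph) (k : ℕ) (p : Partial G k) : Set where
    win : (p' : Partial G k) → LegalMove G k p p' → Loses G k p' → Wins G k p

  data Loses (G : Graph) (k : ℕ) (p : Partial G k) : Set where
    lose : ((p' : Partial G k) → LegalMove G k p p' → Wins G k p') → Loses G k p

emptyColoring : (G : Graph) (k : ℕ) → Partial G k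
emptyColoring G k = λ _ → nothing

Player1Wins : Graph → ℕ → Set
Player1Wins G k = Wins G k (emptyColoring G k)

-- Two colours give only three multisets {a,b} for the five edges of P₆, so no 2-colouring
-- is edge-distinguishing (pigeonhole), while colouring vertex i by ⌊i/2⌋ is; hence λ(P₆) = 3.
-- With three colours, Player 1 wins by opening at a neighbour of an end vertex; the game
-- tree below that opening is checked by exhaustive search. The search is sound because
-- legality of a move is decidable: injectivity of the partial edge colouring only needs
-- comparing the colour pairs of every two edges in a list of all edges.
module Submission where

open import Defs
open import Data.Bool as Bool using (Bool; false; true)
open import Data.Empty using (⊥)
open import Data.Fin using (Fin; zero; suc; toℕ; inject₁; inject≤; quotient; _≟_)
open import Data.Fin.Properties
  using (any?; all?; toℕ-inject₁; toℕ-injective; inject₁-injective; inject≤-injective; injective⇒≤)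
open import Data.Maybe using (Maybe; just; nothing)
open import Data.Maybe.Properties using (≡-dec)
open import Data.Nat as ℕ using (ℕ; suc; _≤_; _<_; s≤s)
open import Data.Nat.Properties using (<-asym; <-cmp; ≤-pred; ≤-reflexive; suc-injective)
open import Data.Product using (_×_; _,_; ∃-syntax; map₂; swap)
open import Data.Sum using (inj₁; inj₂)
open import Data.Vec.Functional using (updateAt)
open import Data.Vec.Functional.Properties using (updateAt-updates; updateAt-minimal)
open import Function using (_∘_; id; const)
open import Function.Definitions using (Injective)
open import Relation.Binary.Definitions using (DecidableEquality; tri<; tri≈; tri>)
open import Relation.Binary.PropositionalEquality using (_≡_; refl; sym; trans; cong; _≗_)
open import Relation.Nullary using (Dec; yes; no; ⌊_⌋; contradiction)
open import Relation.Nullary.Decidable using (_×-dec_; _⊎-dec_; _→-dec_; map′; from-yes)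

module _ {A : Set} where

  samePair-swapˡ : ∀ {a b x y : A} → SamePair a b x y → SamePair b a x y
  samePair-swapˡ (inj₁ (a≡x , b≡y)) = inj₂ (b≡y , a≡x)
  samePair-swapˡ (inj₂ (a≡y , b≡x)) = inj₁ (b≡x , a≡y)

  samePair-swapʳ : ∀ {a b x y : A} → SamePair a b x y → SamePair a b y x
  samePair-swapʳ (inj₁ eqs) = inj₂ eqs
  samePair-swapʳ (inj₂ eqs) = inj₁ eqs

  samePair-sym : ∀ {a b x y : A} → SamePair a b x y → SamePair x y a b
  samePair-sym (inj₁ (refl , refl)) = inj₁ (refl , refl)
  samePair-sym (inj₂ (refl , refl)) = inj₂ (refl , refl)

  samePair-trans : ∀ {a b x y z w : A} → SamePair a b x y → SamePair x y z w → SamePair a b z w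
  samePair-trans (inj₁ (refl , refl)) xy≈zw               = xy≈zw
  samePair-trans (inj₂ (refl , refl)) (inj₁ (refl , refl)) = inj₂ (refl , refl)
  samePair-trans (inj₂ (refl , refl)) (inj₂ (refl , refl)) = inj₁ (refl , refl)

  samePair? : DecidableEquality A → ∀ a b x y → Dec (SamePair a b x y)
  samePair? _≟_ a b x y = ((a ≟ x) ×-dec (b ≟ y)) ⊎-dec ((a ≟ y) ×-dec (b ≟ x))

  samePair-injective : ∀ {B : Set} {f : A → B} → Injective _≡_ _≡_ f →
                       ∀ {a b x y} → SamePair (f a) (f b) (f x) (f y) → SamePair a b x y
  samePair-injective f-inj (inj₁ (fa≡fx , fb≡fy)) = inj₁ (f-inj fa≡fx , f-inj fb≡fy)
  samePair-injective f-inj (inj₂ (fa≡fy , fb≡fx)) = inj₂ (f-inj fa≡fy , f-inj fb≡fx)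

  Clash : (a b x y : Maybe A) → Set
  Clash (just a) (just b) (just x) (just y) = SamePair a b x y
  Clash _        _        _        _        = ⊥

  clash-just : ∀ {m₁ m₂ m₃ m₄ a b x y} →
               m₁ ≡ just a → m₂ ≡ just b → m₃ ≡ just x → m₄ ≡ just y →
               SamePair a b x y → Clash m₁ m₂ m₃ m₄
  clash-just refl refl refl refl = id

  clash? : DecidableEquality A → ∀ a b x y → Dec (Clash a b x y)
  clash? _≟_ (just a) (just b) (just x) (just y) = samePair? _≟_ a b x y
  clash? _   nothing  _        _        _        = no λ ()
  clash? _   (just _) nothing  _        _        = no λ ()
  clash? _   (just _) (just _) nothing  _        = no λ ()
  clash? _   (just _) (just _) (just _) nothing  = no λ ()

record EdgeEnumeration (G : Graph) : Set where
  field
    size           : ℕ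
    end₁ end₂      : Fin size → Fin (n G)
    edge-adj       : ∀ i → Adj G (end₁ i) (end₂ i)
    adj-edge       : ∀ {u v} → Adj G u v → ∃[ i ] SamePair u v (end₁ i) (end₂ i)
    edge-injective : ∀ {i j} → SamePair (end₁ i) (end₂ i) (end₁ j) (end₂ j) → i ≡ j

edgeDistinguishing-∘ : ∀ {G k k′} {f : Fin k → Fin k′} → Injective _≡_ _≡_ f →
                       ∀ {c} → EdgeDistinguishing G k c → EdgeDistinguishing G k′ (f ∘ c)
edgeDistinguishing-∘ f-inj ed u v x y uv xy = ed u v x y uv xy ∘ samePair-injective f-inj

pairCode : Fin 2 → Fin 2 → Fin 3
pairCode zero       zero       = zero
pairCode zero       (suc zero) = suc zero
pairCode (suc zero) zero       = suc zero
pairCode (suc zero) (suc zero) = suc (suc zero)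

pairCode-injective : ∀ a b x y → pairCode a b ≡ pairCode x y → SamePair a b x y
pairCode-injective = from-yes
  (all? λ a → all? λ b → all? λ x → all? λ y →
     (pairCode a b ≟ pairCode x y) →-dec samePair? _≟_ a b x y)

module _ {G : Graph} (E : EdgeEnumeration G) where
  open EdgeEnumeration E

  edgeDistinguishing₂⇒size≤3 : ∀ {c} → EdgeDistinguishing G 2 c → size ≤ 3
  edgeDistinguishing₂⇒size≤3 {c} ed = injective⇒≤ edgeCode-injective
    where
    edgeCode : Fin size → Fin 3
    edgeCode i = pairCode (c (end₁ i)) (c (end₂ i))

    edgeCode-injective : Injective _≡_ _≡_ edgeCode
    edgeCode-injective {i} {j} =
      edge-injective ∘ ed _ _ _ _ (edge-adj i) (edge-adj j) ∘ pairCode-injective _ _ _ _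

  edgeDistinguishing≤2⇒size≤3 : ∀ {k c} → k ≤ 2 → EdgeDistinguishing G k c → size ≤ 3
  edgeDistinguishing≤2⇒size≤3 k≤2 = edgeDistinguishing₂⇒size≤3 ∘
    edgeDistinguishing-∘ (λ {i} {j} → inject≤-injective k≤2 k≤2 i j)

  module _ {k : ℕ} where

    Distinguishing : Partial G k → Set
    Distinguishing p =
      ∀ i j → Clash (p (end₁ i)) (p (end₂ i)) (p (end₁ j)) (p (end₂ j)) → i ≡ j

    distinguishing? : ∀ p → Dec (Distinguishing p)
    distinguishing? p = all? λ i → all? λ j →
      clash? _≟_ (p (end₁ i)) (p (end₂ i)) (p (end₁ j)) (p (end₂ j)) →-dec (i ≟ j)

    clash-along : ∀ {p : Partial G k} {u v x y i j a b a′ b′} →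
                  SamePair u v (end₁ i) (end₂ i) → SamePair x y (end₁ j) (end₂ j) →
                  p u ≡ just a → p v ≡ just b → p x ≡ just a′ → p y ≡ just b′ →
                  SamePair a b a′ b′ → Clash (p (end₁ i)) (p (end₂ i)) (p (end₁ j)) (p (end₂ j))
    clash-along (inj₁ (refl , refl)) (inj₁ (refl , refl)) pu pv px py =
      clash-just pu pv px py
    clash-along (inj₁ (refl , refl)) (inj₂ (refl , refl)) pu pv px py =
      clash-just pu pv py px ∘ samePair-swapʳ
    clash-along (inj₂ (refl , refl)) (inj₁ (refl , refl)) pu pv px py =
      clash-just pv pu px py ∘ samePair-swapˡ
    clash-along (inj₂ (refl , refl)) (inj₂ (refl , refl)) pu pv px py =
      clash-just pv pu py px ∘ samePair-swapˡ ∘ samePair-swapʳ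

    distinguishing⇒partialEdgeDistinguishing : ∀ {p} →
      Distinguishing p → PartialEdgeDistinguishing G k p
    distinguishing⇒partialEdgeDistinguishing d u v x y a b a′ b′ uv xy pu pv px py ab≈a′b′
      with i , uv≈i ← adj-edge uv | j , xy≈j ← adj-edge xy
      with refl ← d i j (clash-along uv≈i xy≈j pu pv px py ab≈a′b′)
      = samePair-trans uv≈i (samePair-sym xy≈j)

    partialEdgeDistinguishing⇒distinguishing : ∀ {p} →
      PartialEdgeDistinguishing G k p → Distinguishing p
    partialEdgeDistinguishing⇒distinguishing {p} ped i j
      with p (end₁ i) in e₁ | p (end₂ i) in e₂ | p (end₁ j) in e₃ | p (end₂ j) in e₄
    ... | just a  | just b  | just a′ | just b′ =
      edge-injective ∘ ped _ _ _ _ a b a′ b′ (edge-adj i) (edge-adj j) e₁ e₂ e₃ e₄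
    ... | nothing | _       | _       | _       = λ ()
    ... | just _  | nothing | _       | _       = λ ()
    ... | just _  | just _  | nothing | _       = λ ()
    ... | just _  | just _  | just _  | nothing = λ ()

    partialEdgeDistinguishing? : ∀ p → Dec (PartialEdgeDistinguishing G k p)
    partialEdgeDistinguishing? p =
      map′ distinguishing⇒partialEdgeDistinguishing partialEdgeDistinguishing⇒distinguishing
           (distinguishing? p)

partialEdgeDistinguishing-just⇒edgeDistinguishing : ∀ {G k c} →
  PartialEdgeDistinguishing G k (just ∘ c) → EdgeDistinguishing G k c
partialEdgeDistinguishing-just⇒edgeDistinguishing ped u v x y uv xy =
  ped u v x y _ _ _ _ uv xy refl refl refl refl

-- Without function extensionality a move determines the new colouring only up to _≗_.
module _ {G : Graph} {k : ℕ} where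

  move-resp-≗ : ∀ {p q r : Partial G k} → p ≗ q → Move G k p r → Move G k q r
  move-resp-≗ p≗q m = record
    { v         = v
    ; c         = c
    ; uncolored = trans (sym (p≗q v)) uncolored
    ; colored   = colored
    ; unchanged = λ w w≢v → trans (unchanged w w≢v) (p≗q w)
    }
    where open Move m

  partialEdgeDistinguishing-resp-≗ : ∀ {p q : Partial G k} → p ≗ q →
    PartialEdgeDistinguishing G k p → PartialEdgeDistinguishing G k q
  partialEdgeDistinguishing-resp-≗ p≗q ped u v x y a b a′ b′ uv xy pu pv px py =
    ped u v x y a b a′ b′ uv xy
      (trans (p≗q u) pu) (trans (p≗q v) pv) (trans (p≗q x) px) (trans (p≗q y) py)

  wins-resp-≗ : ∀ {p q : Partial G k} → p ≗ q → Wins G k p → Wins G k q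
  wins-resp-≗ p≗q (win r (m , ped) r-loses) = win r (move-resp-≗ p≗q m , ped) r-loses

module Moves (G : Graph) (k : ℕ) where

  _[_≔_] : Partial G k → Fin (n G) → Fin k → Partial G k
  p [ v ≔ c ] = updateAt p v (const (just c))

  move-target : ∀ {p p′} (m : Move G k p p′) → p′ ≗ p [ Move.v m ≔ Move.c m ]
  move-target {p} m w with w ≟ Move.v m
  ... | yes refl = trans (Move.colored m) (sym (updateAt-updates w p))
  ... | no w≢v   = trans (Move.unchanged m w w≢v) (sym (updateAt-minimal w (Move.v m) p w≢v))

  Legal : Partial G k → Fin (n G) → Fin k → Set
  Legal p v c = p v ≡ nothing × PartialEdgeDistinguishing G k (p [ v ≔ c ])

  wins-by : ∀ {p v c} → Legal p v c → Loses G k (p [ v ≔ c ]) → Wins G k p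
  wins-by {p} {v} {c} (uncolored , ped) = win (p [ v ≔ c ]) (move , ped)
    where
    move : Move G k p (p [ v ≔ c ])
    move = record
      { v         = v
      ; c         = c
      ; uncolored = uncolored
      ; colored   = updateAt-updates v p
      ; unchanged = λ w w≢v → updateAt-minimal w v p w≢v
      }

-- The fuel f bounds the number of moves the winning player still makes.
module GameSearch {G : Graph} (E : EdgeEnumeration G) (k : ℕ) where

  open Moves G k

  legal? : ∀ p v c → Dec (Legal p v c)
  legal? p v c = ≡-dec _≟_ (p v) nothing ×-dec partialEdgeDistinguishing? E (p [ v ≔ c ])

  wins loses : ℕ → Partial G k → Bool
  winningMove? : ∀ f p → Dec (∃[ v ] ∃[ c ] Legal p v c × loses f (p [ v ≔ c ]) ≡ true)
  everyReplyWins? : ∀ f p → Dec (∀ v c → Legal p v c → wins f (p [ v ≔ c ]) ≡ true)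

  wins ℕ.zero  p = false
  wins (suc f) p = ⌊ winningMove? f p ⌋

  loses f p = ⌊ everyReplyWins? f p ⌋

  winningMove? f p = any? λ v → any? λ c →
    legal? p v c ×-dec (loses f (p [ v ≔ c ]) Bool.≟ true)

  everyReplyWins? f p = all? λ v → all? λ c →
    legal? p v c →-dec (wins f (p [ v ≔ c ]) Bool.≟ true)

  wins-sound : ∀ f p → wins f p ≡ true → Wins G k p
  loses-sound : ∀ f p → loses f p ≡ true → Loses G k p

  wins-sound (suc f) p with winningMove? f p
  ... | yes (v , c , legal , loses≡true) = λ _ → wins-by legal (loses-sound f _ loses≡true)
  ... | no _                             = λ ()

  loses-sound f p with everyReplyWins? f p
  ... | no _      = λ ()
  ... | yes reply = λ _ → lose λ p′ (m , ped) →
    let p′≗target = move-target m in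
    wins-resp-≗ (sym ∘ p′≗target)
      (wins-sound f _ (reply (Move.v m) (Move.c m)
        (Move.uncolored m , partialEdgeDistinguishing-resp-≗ p′≗target ped)))

path-edge : ∀ {m} {u v : Fin (suc m)} → toℕ v ≡ suc (toℕ u) →
            ∃[ i ] u ≡ inject₁ i × v ≡ suc i
path-edge {u = u} {suc i} 1+i≡1+u =
  i , toℕ-injective (trans (sym (suc-injective 1+i≡1+u)) (sym (toℕ-inject₁ i))) , refl

pathEdge-injective : ∀ {m} {i j : Fin m} →
                     SamePair (inject₁ i) (suc i) (inject₁ j) (suc j) → i ≡ j
pathEdge-injective (inj₁ (i≡j , _)) = inject₁-injective i≡j
pathEdge-injective {i = i} {j} (inj₂ (i≡1+j , 1+i≡j)) = contradiction j<i (<-asym i<j)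
  where
  j<i : toℕ j < toℕ i
  j<i = ≤-reflexive (sym (trans (sym (toℕ-inject₁ i)) (cong toℕ i≡1+j)))
  i<j : toℕ i < toℕ j
  i<j = ≤-reflexive (trans (cong toℕ 1+i≡j) (toℕ-inject₁ j))

pathEdges : ∀ m → EdgeEnumeration (Path (suc m))
pathEdges m = record
  { size           = m
  ; end₁           = inject₁
  ; end₂           = suc
  ; edge-adj       = λ i → inj₁ (cong suc (sym (toℕ-inject₁ i)))
  ; adj-edge       = λ { (inj₁ v≡1+u) → map₂ inj₁ (path-edge v≡1+u)
                       ; (inj₂ u≡1+v) → map₂ (inj₂ ∘ swap) (path-edge u≡1+v) }
  ; edge-injective = pathEdge-injective
  }

open Moves (Path 6) 3
open GameSearch (pathEdges 5) 3

halving : Fin 6 → Fin 3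
halving = quotient 2

halving-edgeDistinguishing : EdgeDistinguishing (Path 6) 3 halving
halving-edgeDistinguishing = partialEdgeDistinguishing-just⇒edgeDistinguishing
  (from-yes (partialEdgeDistinguishing? (pathEdges 5) (just ∘ halving)))

lambda-path₆ : ∀ {k} → IsLambda (Path 6) k → k ≡ 3
lambda-path₆ {k} ((c , ed) , minimal) with <-cmp k 3
... | tri< k<3 _ _ = contradiction (edgeDistinguishing≤2⇒size≤3 (pathEdges 5) (≤-pred k<3) ed)
                                   λ { (s≤s (s≤s (s≤s ()))) }
... | tri≈ _ k≡3 _ = k≡3
... | tri> _ _ 3<k = contradiction (halving , halving-edgeDistinguishing) (minimal 3 3<k)

opening : Partial (Path 6) 3
opening = emptyColoring (Path 6) 3 [ suc zero ≔ zero ]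

player1-wins-path₆ : Player1Wins (Path 6) 3
player1-wins-path₆ = wins-by {v = suc zero} {c = zero}
  (refl , from-yes (partialEdgeDistinguishing? (pathEdges 5) opening))
  (loses-sound 2 opening refl)

theorem3p11 : (k : ℕ) → IsLambda (Path 6) k → Player1Wins (Path 6) k
theorem3p11 k isλ with refl ← lambda-path₆ isλ = player1-wins-path₆
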